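{- Let $G$ be a connected bipartite graph, and let $Y$ be a Gyárfás decomposition of $G$. Then every bag of $Y$ is an independent set in $G$. Moreover, vertices in bags of odd levels belong to one side of the bipartition, and vertices in bags of even levels belong to the other side of the bipartition.
   Context: A Gyárfás decomposition of a connected graph $G$ is a rooted tree $Y$ such that: (1) the nodes of $Y$ (bags) are pairwise disjoint non-empty subsets of $V(G)$ whose union is $V(G)$; (2) the root bag consists of a single vertex; (3) if $u\in B$ and $u'\in B'$ are adjacent in $G$ for bags $B,B'$, then one of $B,B'$ is an ancestor of the other (every node is its own ancestor); (4) for every bag $B$, the subgraph induced by the union of $B$ and all its descendants is connected; (5) for every non-root bag $B$ there is a vertex $h(B)$ in the parent bag of $B$ adjacent to all vertices of $B$ and non-adjacent to all vertices in strict descendants of $B$. The level of a bag is the number of edges on the path in $Y$ from it to the root. -}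

module Defs where

open import Data.Nat using (ℕ; zero; suc)
open import Data.Fin using (Fin)
open import Data.Bool using (Bool; true; false; not)
open import Data.Maybe using (Maybe; just; nothing)
open import Data.Product using (Σ; ∃; _×_; _,_)
open import Data.Sum using (_⊎_)
open import Data.Unit using (⊤)
open import Relation.Nullary using (¬_)
open import Relation.Binary.PropositionalEquality using (_≡_; _≢_)

record Graph (n : ℕ) : Set₁ where
  field
    Adj     : Fin n → Fin n → Set
    sym     : ∀ {u v} → Adj u v → Adj v u
    irrefl  : ∀ {u} → ¬ Adj u u
open Graph public

data WalkIn {n : ℕ} (G : Graph n) (P : Fin n → Set) : Fin n → Fin n → Set where
  here : ∀ {u} → P u → WalkIn G P u u
  step : ∀ {u w v} → P u → Adj G u w → WalkIn G P w v → WalkIn G P u v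

Connected : {n : ℕ} → Graph n → Set
Connected {n} G = ∀ (u v : Fin n) → WalkIn G (λ _ → ⊤) u v

-- Bipartition given by a proper 2-colouring (the two sides are the colour classes).
ProperTwoColouring : {n : ℕ} → Graph n → (Fin n → Bool) → Set
ProperTwoColouring G c = ∀ {u v} → Adj G u v → c u ≢ c v

IndependentSet : {n : ℕ} → Graph n → (Fin n → Set) → Set
IndependentSet G S = ∀ u v → S u → S v → ¬ Adj G u v

-- A rooted tree on nodes Fin m is given by a parent map (nothing = root).
-- Level par B k : bag B has level k (k edges to the root).
data Level {m : ℕ} (par : Fin m → Maybe (Fin m)) : Fin m → ℕ → Set where
  lvl-root : ∀ {B} → par B ≡ nothing → Level par B zero
  lvl-step : ∀ {B P k} → par B ≡ just P → Level par P k → Level par B (suc k)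

data Ancestor {m : ℕ} (par : Fin m → Maybe (Fin m)) (A : Fin m) : Fin m → Set where
  anc-refl : Ancestor par A A
  anc-step : ∀ {B P} → par B ≡ just P → Ancestor par A P → Ancestor par A B

record Gyarfas {n : ℕ} (G : Graph n) : Set where
  field
    m      : ℕ
    bag    : Fin n → Fin m                   -- bag containing each vertex (bags disjoint, cover V)
    parent : Fin m → Maybe (Fin m)
    root   : Fin m
    root-is-root : parent root ≡ nothing
    root-unique  : ∀ B → parent B ≡ nothing → B ≡ root
    has-level    : ∀ B → Σ ℕ (λ k → Level parent B k)   -- every node reaches the root (acyclic)
    nonempty     : ∀ B → ∃ λ v → bag v ≡ B
    root-single  : ∀ u v → bag u ≡ root → bag v ≡ root → u ≡ v
    edges-comparable : ∀ u v → Adj G u v →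
      Ancestor parent (bag u) (bag v) ⊎ Ancestor parent (bag v) (bag u)
    subtree-connected : ∀ B u v →
      Ancestor parent B (bag u) → Ancestor parent B (bag v) →
      WalkIn G (λ w → Ancestor parent B (bag w)) u v
    hub : ∀ B P → parent B ≡ just P → ∃ λ h → bag h ≡ P ×
      (∀ v → bag v ≡ B → Adj G h v) ×
      (∀ v → Ancestor parent B (bag v) → bag v ≢ B → ¬ Adj G h v)
open Gyarfas public

odd : ℕ → Bool
odd zero = false
odd (suc k) = not (odd k)

{-# OPTIONS --safe #-}
module Submission where

open import Defs
open import Data.Nat using (ℕ; zero; suc)
open import Data.Fin using (Fin)
open import Data.Bool using (Bool; _xor_; not)
open import Data.Bool.Properties using (¬-not; not-distribʳ-xor; xor-identityʳ)
open import Data.Product using (∃; _×_; _,_; proj₁; proj₂)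
open import Relation.Binary.PropositionalEquality
  using (_≡_; refl; cong; subst; trans; module ≡-Reasoning)
  renaming (sym to ≡-sym)

-- Only the hubs h(B) matter: each vertex of a bag B is adjacent to the hub of B, which lies
-- in the parent bag, so the colour flips with every level. Since the root bag is a single
-- vertex r, every vertex at level k has colour c r xor odd k, which gives both claims at once.

module _ {n : ℕ} {G : Graph n} {c : Fin n → Bool} (proper : ProperTwoColouring G c)
         (Y : Gyarfas G) where

  rootVertex : Fin n
  rootVertex = proj₁ (nonempty Y (root Y))

  colour-at-level : ∀ {B k} → Level (parent Y) B k →
                      ∀ v → bag Y v ≡ B → c v ≡ c rootVertex xor odd k
  colour-at-level {B} (lvl-root B-is-root) v v∈B = begin
      c v                          ≡⟨ cong c v≡r ⟩
      c rootVertex                 ≡⟨ ≡-sym (xor-identityʳ (c rootVertex)) ⟩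
      c rootVertex xor odd zero    ∎
    where
      open ≡-Reasoning
      v≡r : v ≡ rootVertex
      v≡r = root-single Y v rootVertex
              (subst (bag Y v ≡_) (root-unique Y B B-is-root) v∈B)
              (proj₂ (nonempty Y (root Y)))
  colour-at-level {B} (lvl-step {P = P} {k} B-child-of-P lvlP) v v∈B
    with hub Y B P B-child-of-P
  ... | h , h∈P , h-adj-B , _ = begin
      c v                              ≡⟨ ¬-not (λ cv≡ch → proper (h-adj-B v v∈B) (≡-sym cv≡ch)) ⟩
      not (c h)                        ≡⟨ cong not (colour-at-level lvlP h h∈P) ⟩
      not (c rootVertex xor odd k)     ≡⟨ not-distribʳ-xor (c rootVertex) (odd k) ⟩
      c rootVertex xor odd (suc k)     ∎
    where open ≡-Reasoning

lemma3p4 : ∀ {n} (G : Graph n) → Connected G → (c : Fin n → Bool) → ProperTwoColouring G c →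
    (Y : Gyarfas G) →
    (∀ (B : Fin (m Y)) → IndependentSet G (λ v → bag Y v ≡ B)) ×
    ∃ λ (b : Bool) → ∀ (v : Fin n) (k : ℕ) → Level (parent Y) (bag Y v) k → c v ≡ b xor odd k
lemma3p4 G _ c proper Y = bagsIndependent , c (rootVertex proper Y) , levelColour
  where
    bagsIndependent : ∀ B → IndependentSet G (λ v → bag Y v ≡ B)
    bagsIndependent B u v u∈B v∈B u~v with has-level Y B
    ... | _ , lvlB = proper u~v (trans (colour-at-level proper Y lvlB u u∈B)
                                       (≡-sym (colour-at-level proper Y lvlB v v∈B)))

    levelColour : ∀ v k → Level (parent Y) (bag Y v) k → c v ≡ c (rootVertex proper Y) xor odd k
    levelColour v _ lvl = colour-at-level proper Y lvl v refl
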